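{- Let $H$ be a graph with $o(H)=\mathcal{N}$ and $\gamma_{\mathrm{MB}}(H)=\gamma(H)$, and let $G$ be a graph with $n(G)\geq 2$. Then $\gamma_{\mathrm{MB}}(G\odot H)=1+(n(G)-1)\gamma_{\mathrm{MB}}(H)$ and $\gamma_{\mathrm{MB}}'(G\odot H)=n(G)\gamma_{\mathrm{MB}}(H)$. In particular, if $H$ is a graph with $o(H)=\mathcal{N}$ and $\gamma_{\mathrm{MB}}(H)=2$, then $\gamma_{\mathrm{MB}}(G\odot H)=2n(G)-1$ and $\gamma_{\mathrm{MB}}'(G\odot H)=2n(G)$.
   Context: All graphs are finite and simple; $n(G)$ denotes the order of $G$ and $\gamma(H)$ the domination number of $H$. The Maker-Breaker domination game on a graph $G$: Dominator and Staller alternately select a not yet selected vertex of $G$. Dominator wins if his selected vertices contain a dominating set of $G$; Staller wins if she selects at least one vertex from every dominating set of $G$. In the D-game Dominator moves first, in the S-game Staller moves first. $\gamma_{\mathrm{MB}}(G)$ (resp. $\gamma_{\mathrm{MB}}'(G)$) is the minimum number of moves Dominator needs to win the D-game (resp. S-game) on $G$ when both players play optimally, and is $\infty$ if Dominator has no winning strategy. The outcome $o(H)=\mathcal{N}$ means that in each of the D-game and the S-game on $H$ the player who moves first has a winning strategy. The corona $G\odot H$ is obtained from one copy of $G$ and $n(G)$ disjoint copies of $H$ by joining the $i$-th vertex of $G$ to every vertex of the $i$-th copy of $H$. -}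

module Defs where

open import Data.Nat using (ℕ; zero; suc; _+_; _*_; _≤_)
open import Data.Fin using (Fin; splitAt; remQuot)
open import Data.Fin.Properties using (_≟_)
open import Data.Fin.Subset using (Subset; _∈_; _∉_; _∪_; ⁅_⁆; ∣_∣)
  renaming (⊥ to ∅)
open import Data.Bool using (Bool; true; false; _∧_)
open import Data.Sum using (_⊎_; inj₁; inj₂)
open import Data.Product using (Σ; ∃; _×_; _,_)
open import Relation.Binary.PropositionalEquality using (_≡_)
open import Relation.Nullary using (¬_)
open import Relation.Nullary.Decidable using (⌊_⌋)

record Graph : Set where
  field
    order : ℕ
    adj   : Fin order → Fin order → Bool
open Graph public

IsSimple : Graph → Set
IsSimple G = (∀ u v → adj G u v ≡ adj G v u) × (∀ v → adj G v v ≡ false)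

Dominating : (G : Graph) → Subset (order G) → Set
Dominating G X = ∀ v → v ∈ X ⊎ Σ (Fin (order G)) (λ u → u ∈ X × adj G u v ≡ true)

IsDominationNumber : Graph → ℕ → Set
IsDominationNumber G k =
  Σ (Subset (order G)) (λ X → Dominating G X × ∣ X ∣ ≡ k)
  × (∀ X → Dominating G X → k ≤ ∣ X ∣)

data Turn : Set where
  dom stal : Turn

Free : {n : ℕ} → Subset n → Subset n → Fin n → Set
Free D S v = v ∉ D × v ∉ S

-- DWin G D S t k : from the position where Dominator has selected D, Staller
-- has selected S and player t is to move, Dominator has a strategy that
-- guarantees that his selected vertices contain a dominating set of G after
-- at most k further moves of his.
data DWin (G : Graph) : Subset (order G) → Subset (order G) → Turn → ℕ → Set where
  done : ∀ {D S t k} → Dominating G D → DWin G D S t k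
  dmove : ∀ {D S k} (v : Fin (order G)) → Free D S v →
          DWin G (D ∪ ⁅ v ⁆) S stal k → DWin G D S dom (suc k)
  smove : ∀ {D S k} → Σ (Fin (order G)) (Free D S) →
          (∀ v → Free D S v → DWin G D (S ∪ ⁅ v ⁆) dom k) →
          DWin G D S stal k

-- SWin G D S t : from that position Staller has a strategy guaranteeing that
-- her selected vertices meet every dominating set of G.
data SWin (G : Graph) : Subset (order G) → Subset (order G) → Turn → Set where
  hit : ∀ {D S t} →
        (∀ X → Dominating G X → Σ (Fin (order G)) (λ v → v ∈ X × v ∈ S)) →
        SWin G D S t
  smove : ∀ {D S} (v : Fin (order G)) → Free D S v →
          SWin G D (S ∪ ⁅ v ⁆) dom → SWin G D S stal
  dmove : ∀ {D S} → Σ (Fin (order G)) (Free D S) →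
          (∀ v → Free D S v → SWin G (D ∪ ⁅ v ⁆) S stal) →
          SWin G D S dom

IsγMB : Graph → ℕ → Set
IsγMB G k = DWin G ∅ ∅ dom k × (∀ j → DWin G ∅ ∅ dom j → k ≤ j)

IsγMB' : Graph → ℕ → Set
IsγMB' G k = DWin G ∅ ∅ stal k × (∀ j → DWin G ∅ ∅ stal j → k ≤ j)

OutcomeN : Graph → Set
OutcomeN G = Σ ℕ (DWin G ∅ ∅ dom) × SWin G ∅ ∅ stal

-- Corona G ⊙ H.  Vertices: Fin (n + n * m), n = n(G), m = n(H).
-- The first n vertices are the copy of G; vertex (i , a) of Fin n × Fin m
-- (encoded via remQuot) is vertex a of the i-th copy of H.
coronaAdj : (G H : Graph) → Fin (order G + order G * order H) →
            Fin (order G + order G * order H) → Bool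
coronaAdj G H u v with splitAt (order G) u | splitAt (order G) v
... | inj₁ i | inj₁ j = adj G i j
... | inj₁ i | inj₂ p with remQuot {order G} (order H) p
...   | (i' , _) = ⌊ i ≟ i' ⌋
coronaAdj G H u v | inj₂ p | inj₁ j with remQuot {order G} (order H) p
...   | (j' , _) = ⌊ j ≟ j' ⌋
coronaAdj G H u v | inj₂ p | inj₂ q with remQuot {order G} (order H) p | remQuot {order G} (order H) q
...   | (i , a) | (j , b) = ⌊ i ≟ j ⌋ ∧ adj H a b

_⊙_ : Graph → Graph → Graph
G ⊙ H = record { order = order G + order G * order H ; adj = coronaAdj G H }

-- The corona G ⊙ H consists of n = n(G) blocks, an apex g_i joined to a copy
-- H_i of H, and a set dominates it iff in every block it contains g_i or
-- dominates H_i.  Let k = γ_MB(H) = γ(H).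
--
-- Dominator answers each Staller move inside the same block: a move in H_i
-- while g_i is free is answered by taking g_i, and once Staller owns g_i he
-- follows his D-game strategy on H_i.  So each block costs him at most k
-- moves, and in the D-game his opening move g_i settles one block at once.
--
-- Staller answers Dominator's first move in some H_i by taking g_i, and
-- otherwise takes a free apex g_p of an untouched block.  As o(H) = N she then
-- wins the S-game on H_p unless Dominator answers inside H_p at once.  Hence
-- Dominator gets at most one apex, and none in the S-game, and has to
-- dominate every other H_i himself with at least γ(H) = k of its vertices;
-- the potential Σ_i (0 if g_i is his, k ∸ |D ∩ H_i| otherwise) drops by at
-- most k at his apex move and by at most one at any other move.

module Submission where

open import Data.Bool using (true; _∧_)
import Data.Bool.Properties as Bool
open import Data.Empty using (⊥-elim)
open import Data.Fin using (Fin; zero; suc; fromℕ<; _↑ˡ_; _↑ʳ_; splitAt; combine; remQuot)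
open import Data.Fin.Properties
  using (_≟_; any?; all?; ¬∀⟶∃¬; punchInᵢ≢i; splitAt-↑ˡ; splitAt-↑ʳ; splitAt⁻¹-↑ˡ; splitAt⁻¹-↑ʳ;
         remQuot-combine; combine-remQuot; ↑ʳ-injective)
open import Data.Fin.Subset
  using (Subset; ⊤; _∈_; _∉_; _⊆_; _⊂_; _∪_; ⁅_⁆; ∣_∣; ∁; inside; outside)
  renaming (⊥ to ∅)
open import Data.Fin.Subset.Properties
  using (_∈?_; x∈⁅x⁆; x∈⁅y⁆⇒x≡y; ∣⁅x⁆∣≡1; p⊆p∪q; q⊆p∪q; x∈p∪q⁻; ∪-identityʳ;
         p⊆q⇒∣p∣≤∣q∣; p⊂q⇒∣p∣<∣q∣; x∈p⇒∣p-x∣<∣p∣; x∈p∧x≢y⇒x∈p-y;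
         x∈p⇒x∉∁p; x∈∁p⇒x∉p; x∉p⇒x∈∁p; ∪-assoc; ∪-comm; ⊆-antisym; ∉⊥; ⊥⊆; ∣⊥∣≡0; ∈⊤)
open import Data.Nat using (ℕ; zero; suc; _+_; _*_; _∸_; _≤_; _<_; s≤s; z≤n)
open import Data.Nat.Induction using (<-wellFounded)
open import Data.Nat.Properties hiding (_≟_)
open import Data.Product using (Σ; ∃; _×_; _,_; proj₁; proj₂; map)
open import Data.Sum using (_⊎_; inj₁; inj₂; [_,_]′)
open import Data.Vec using (_∷_; tabulate; lookup)
open import Data.Vec.Properties using (lookup∘tabulate; []=⇒lookup; lookup⇒[]=)
open import Data.Vec.Functional using (Vector; removeAt; updateAt)
open import Data.Vec.Functional.Properties using (updateAt-updates; updateAt-minimal)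
open import Function using (_∘_; id)
open import Induction.WellFounded using (Acc; acc)
open import Relation.Binary.PropositionalEquality
open import Relation.Nullary using (¬_; Dec; yes; no)
open import Relation.Nullary.Decidable using (⌊_⌋; ¬?; _×-dec_; _⊎-dec_)

open import Algebra.Properties.CommutativeMonoid.Sum +-0-commutativeMonoid
  using (sum; sum-remove; sum-cong-≗)

open import Defs

∈-∪⁅⁆⁻ : ∀ {n} {x y : Fin n} {p : Subset n} → x ∈ p ∪ ⁅ y ⁆ → x ∈ p ⊎ x ≡ y
∈-∪⁅⁆⁻ {y = y} {p} x∈ with x∈p∪q⁻ p ⁅ y ⁆ x∈
... | inj₁ x∈p = inj₁ x∈p
... | inj₂ x∈y = inj₂ (x∈⁅y⁆⇒x≡y y x∈y)

y∈p∪⁅y⁆ : ∀ {n} (p : Subset n) y → y ∈ p ∪ ⁅ y ⁆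
y∈p∪⁅y⁆ p y = q⊆p∪q p ⁅ y ⁆ (x∈⁅x⁆ y)

∉-∪⁅⁆ : ∀ {n} {x y : Fin n} {p : Subset n} → x ∉ p → x ≢ y → x ∉ p ∪ ⁅ y ⁆
∉-∪⁅⁆ x∉p x≢y x∈ with ∈-∪⁅⁆⁻ x∈
... | inj₁ x∈p = x∉p x∈p
... | inj₂ x≡y = x≢y x≡y

∪⁅⁆-⊆ : ∀ {n} {y : Fin n} {p q : Subset n} → p ⊆ q → y ∈ q → p ∪ ⁅ y ⁆ ⊆ q
∪⁅⁆-⊆ p⊆q y∈q x∈ with ∈-∪⁅⁆⁻ x∈
... | inj₁ x∈p = p⊆q x∈p
... | inj₂ refl = y∈q

∪⁅⁆-mono : ∀ {n} {y : Fin n} {p q : Subset n} → p ⊆ q → p ∪ ⁅ y ⁆ ⊆ q ∪ ⁅ y ⁆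
∪⁅⁆-mono {y = y} {q = q} p⊆q = ∪⁅⁆-⊆ (λ x∈p → p⊆p∪q ⁅ y ⁆ (p⊆q x∈p)) (y∈p∪⁅y⁆ q y)

∣p∪⁅x⁆∣≤1+∣p∣ : ∀ {n} (p : Subset n) x → ∣ p ∪ ⁅ x ⁆ ∣ ≤ suc ∣ p ∣
∣p∪⁅x⁆∣≤1+∣p∣ (outside ∷ p) zero    rewrite ∪-identityʳ p = ≤-refl
∣p∪⁅x⁆∣≤1+∣p∣ (inside ∷ p)  zero    rewrite ∪-identityʳ p = n≤1+n _
∣p∪⁅x⁆∣≤1+∣p∣ (outside ∷ p) (suc x) = ∣p∪⁅x⁆∣≤1+∣p∣ p x
∣p∪⁅x⁆∣≤1+∣p∣ (inside ∷ p)  (suc x) = s≤s (∣p∪⁅x⁆∣≤1+∣p∣ p x)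

x∈p⇒1≤∣p∣ : ∀ {n} {x : Fin n} {p : Subset n} → x ∈ p → 1 ≤ ∣ p ∣
x∈p⇒1≤∣p∣ {x = x} x∈p =
  subst (_≤ _) (∣⁅x⁆∣≡1 x) (p⊆q⇒∣p∣≤∣q∣ (λ y∈x → subst (_∈ _) (sym (x∈⁅y⁆⇒x≡y x y∈x)) x∈p))

x,y∈p⇒2≤∣p∣ : ∀ {n} {x y : Fin n} {p : Subset n} → x ∈ p → y ∈ p → x ≢ y → 2 ≤ ∣ p ∣
x,y∈p⇒2≤∣p∣ x∈p y∈p x≢y =
  ≤-trans (s≤s (x∈p⇒1≤∣p∣ (x∈p∧x≢y⇒x∈p-y y∈p (x≢y ∘ sym)))) (x∈p⇒∣p-x∣<∣p∣ x∈p)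

∁-∪⁅⁆-⊂ : ∀ {n} {x : Fin n} {p : Subset n} → x ∉ p → ∁ (p ∪ ⁅ x ⁆) ⊂ ∁ p
∁-∪⁅⁆-⊂ {x = x} {p} x∉p =
  (λ y∈ → x∉p⇒x∈∁p (λ y∈p → x∈∁p⇒x∉p y∈ (p⊆p∪q ⁅ x ⁆ y∈p))) ,
  x , x∉p⇒x∈∁p x∉p , x∈p⇒x∉∁p (y∈p∪⁅y⁆ p x)

sum-const : ∀ n x → sum {n} (λ _ → x) ≡ n * x
sum-const zero    x = refl
sum-const (suc n) x = cong (x +_) (sum-const n x)

sum-≤-at : ∀ {n} {f g : Vector ℕ n} j → (∀ i → i ≢ j → f i ≡ g i) →
           ∀ δ ε → δ + f j ≤ ε + g j → δ + sum f ≤ ε + sum g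
sum-≤-at {suc n} {f} {g} j agree δ ε fj≤ = begin
  δ + sum f                      ≡⟨ cong (δ +_) (sum-remove f) ⟩
  δ + (f j + sum (removeAt f j)) ≡⟨ +-assoc δ (f j) _ ⟨
  (δ + f j) + sum (removeAt f j) ≡⟨ cong ((δ + f j) +_) (sum-cong-≗ (λ i → agree _ (punchInᵢ≢i j i))) ⟩
  (δ + f j) + sum (removeAt g j) ≤⟨ +-monoˡ-≤ _ fj≤ ⟩
  (ε + g j) + sum (removeAt g j) ≡⟨ +-assoc ε (g j) _ ⟩
  ε + (g j + sum (removeAt g j)) ≡⟨ cong (ε +_) (sum-remove g) ⟨
  ε + sum g                      ∎
  where open ≤-Reasoning

sum-updateAt-const : ∀ {n} (j : Fin n) x y → sum (updateAt (λ _ → x) j (λ _ → y)) ≡ y + (n ∸ 1) * x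
sum-updateAt-const {suc n} j x y = begin
  sum c                    ≡⟨ sum-remove c ⟩
  c j + sum (removeAt c j) ≡⟨ cong₂ _+_ (updateAt-updates j _)
                                      (sum-cong-≗ (λ i → updateAt-minimal _ j _ (punchInᵢ≢i j i))) ⟩
  y + sum {n} (λ _ → x)    ≡⟨ cong (y +_) (sum-const n x) ⟩
  y + n * x                ∎
  where
  c = updateAt (λ _ → x) j (λ _ → y)
  open ≡-Reasoning

sum-updateAt-< : ∀ {n} (c : Vector ℕ n) j {y} → y < c j → sum (updateAt c j (λ _ → y)) < sum c
sum-updateAt-< c j y<cj =
  sum-≤-at j (λ i i≢j → updateAt-minimal i j c i≢j) 1 0
    (subst (λ z → 1 + z ≤ c j) (sym (updateAt-updates j c)) y<cj)

Disjoint : ∀ {n} → Subset n → Subset n → Set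
Disjoint D S = ∀ {v} → v ∈ D → v ∉ S

Disjoint-∅ : ∀ {n} → Disjoint {n} ∅ ∅
Disjoint-∅ v∈∅ _ = ∉⊥ v∈∅

module _ {n} {D S : Subset n} {v : Fin n} where

  Free-∪ᴰ⁻ : ∀ {u} → Free (D ∪ ⁅ v ⁆) S u → Free D S u
  Free-∪ᴰ⁻ (u∉D∪v , u∉S) = (λ u∈D → u∉D∪v (p⊆p∪q ⁅ v ⁆ u∈D)) , u∉S

  Free-∪ˢ⁻ : ∀ {u} → Free D (S ∪ ⁅ v ⁆) u → Free D S u
  Free-∪ˢ⁻ (u∉D , u∉S∪v) = u∉D , (λ u∈S → u∉S∪v (p⊆p∪q ⁅ v ⁆ u∈S))

  ¬Free-∪ᴰ : ¬ Free (D ∪ ⁅ v ⁆) S v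
  ¬Free-∪ᴰ (v∉D∪v , _) = v∉D∪v (y∈p∪⁅y⁆ D v)

  ¬Free-∪ˢ : ¬ Free D (S ∪ ⁅ v ⁆) v
  ¬Free-∪ˢ (_ , v∉S∪v) = v∉S∪v (y∈p∪⁅y⁆ S v)

  Disjoint-∪ᴰ : Disjoint D S → v ∉ S → Disjoint (D ∪ ⁅ v ⁆) S
  Disjoint-∪ᴰ D#S v∉S x∈ with ∈-∪⁅⁆⁻ x∈
  ... | inj₁ x∈D = D#S x∈D
  ... | inj₂ refl = v∉S

  Disjoint-∪ˢ : Disjoint D S → v ∉ D → Disjoint D (S ∪ ⁅ v ⁆)
  Disjoint-∪ˢ D#S v∉D x∈D x∈ with ∈-∪⁅⁆⁻ x∈
  ... | inj₁ x∈S = D#S x∈D x∈S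
  ... | inj₂ refl = v∉D x∈D

free? : ∀ {n} (D S : Subset n) → Dec (∃ (Free D S))
free? D S = any? (λ v → ¬? (v ∈? D) ×-dec ¬? (v ∈? S))

free-count : ∀ {n} → Subset n → Subset n → ℕ
free-count D S = ∣ ∁ (D ∪ S) ∣

module _ {n} {D S : Subset n} {v : Fin n} (v-free : Free D S v) where

  private
    v∉D∪S : v ∉ D ∪ S
    v∉D∪S v∈ with x∈p∪q⁻ D S v∈
    ... | inj₁ v∈D = proj₁ v-free v∈D
    ... | inj₂ v∈S = proj₂ v-free v∈S

  free-count-∪ᴰ : free-count (D ∪ ⁅ v ⁆) S < free-count D S
  free-count-∪ᴰ =
    subst (λ X → ∣ ∁ X ∣ < free-count D S) (sym reorder) (p⊂q⇒∣p∣<∣q∣ (∁-∪⁅⁆-⊂ v∉D∪S))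
    where
    reorder : (D ∪ ⁅ v ⁆) ∪ S ≡ (D ∪ S) ∪ ⁅ v ⁆
    reorder = begin
      (D ∪ ⁅ v ⁆) ∪ S ≡⟨ ∪-assoc D ⁅ v ⁆ S ⟩
      D ∪ (⁅ v ⁆ ∪ S) ≡⟨ cong (D ∪_) (∪-comm ⁅ v ⁆ S) ⟩
      D ∪ (S ∪ ⁅ v ⁆) ≡⟨ ∪-assoc D S ⁅ v ⁆ ⟨
      (D ∪ S) ∪ ⁅ v ⁆ ∎
      where open ≡-Reasoning

  free-count-∪ˢ : free-count D (S ∪ ⁅ v ⁆) < free-count D S
  free-count-∪ˢ =
    subst (λ X → ∣ ∁ X ∣ < free-count D S) (∪-assoc D S ⁅ v ⁆) (p⊂q⇒∣p∣<∣q∣ (∁-∪⁅⁆-⊂ v∉D∪S))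

Hits : (G : Graph) → Subset (order G) → Set
Hits G S = ∀ X → Dominating G X → Σ (Fin (order G)) (λ v → v ∈ X × v ∈ S)

dominating? : ∀ G X → Dec (Dominating G X)
dominating? G X = all? (λ v → v ∈? X ⊎-dec any? (λ u → u ∈? X ×-dec adj G u v Bool.≟ true))

module _ {G : Graph} where

  private
    variable
      D S S′ X Y : Subset (order G)
      t : Turn
      c c′ : ℕ

  Dominating-⊆ : X ⊆ Y → Dominating G X → Dominating G Y
  Dominating-⊆ X⊆Y dom-X v with dom-X v
  ... | inj₁ v∈X = inj₁ (X⊆Y v∈X)
  ... | inj₂ (u , u∈X , uv) = inj₂ (u , X⊆Y u∈X , uv)

  Hits-⊆ : S ⊆ S′ → Hits G S → Hits G S′
  Hits-⊆ S⊆S′ hits X dom-X with hits X dom-X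
  ... | v , v∈X , v∈S = v , v∈X , S⊆S′ v∈S

  -- Once no vertex is free, every dominating set avoiding S lies inside D.
  stuck⇒Hits : ¬ ∃ (Free D S) → ¬ Dominating G D → Hits G S
  stuck⇒Hits {D} {S} stuck ¬dom-D X dom-X with any? (λ v → v ∈? X ×-dec v ∈? S)
  ... | yes v∈X∩S = v∈X∩S
  ... | no miss = ⊥-elim (¬dom-D (Dominating-⊆ X⊆D dom-X))
    where
    X⊆D : X ⊆ D
    X⊆D {v} v∈X with v ∈? D | v ∈? S
    ... | yes v∈D | _       = v∈D
    ... | no  _   | yes v∈S = ⊥-elim (miss (v , v∈X , v∈S))
    ... | no  v∉D | no  v∉S = ⊥-elim (stuck (v , v∉D , v∉S))

  SWin⇒¬Dominating : SWin G D S t → Disjoint D S → ¬ Dominating G D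
  SWin⇒¬Dominating {D} (hit hits) D#S dom-D with hits D dom-D
  ... | v , v∈D , v∈S = D#S v∈D v∈S
  SWin⇒¬Dominating (smove v (v∉D , _) w) D#S =
    SWin⇒¬Dominating w (Disjoint-∪ˢ D#S v∉D)
  SWin⇒¬Dominating (dmove (w , w∉D , w∉S) g) D#S dom-D =
    SWin⇒¬Dominating (g w (w∉D , w∉S)) (Disjoint-∪ᴰ D#S w∉S) (Dominating-⊆ (p⊆p∪q _) dom-D)

  DWin-≤ : c ≤ c′ → DWin G D S t c → DWin G D S t c′
  DWin-≤ _         (done dom-D)  = done dom-D
  DWin-≤ (s≤s c≤c′) (dmove v fv w) = dmove v fv (DWin-≤ c≤c′ w)
  DWin-≤ c≤c′      (smove fw f)  = smove fw (λ v fv → DWin-≤ c≤c′ (f v fv))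

  Free-⊆ˢ : S ⊆ S′ → ∀ {v} → Free D S′ v → Free D S v
  Free-⊆ˢ S⊆S′ (v∉D , v∉S′) = v∉D , (λ v∈S → v∉S′ (S⊆S′ v∈S))

  -- A Staller move onto a vertex she already owns in the given strategy is
  -- answered as if she had played the first move that strategy allows.
  DWin-⊇ˢ : S ⊆ S′ → DWin G D S′ t c → DWin G D S t c
  DWin-⊇ˢ _     (done dom-D)   = done dom-D
  DWin-⊇ˢ S⊆S′ (dmove v fv w) = dmove v (Free-⊆ˢ S⊆S′ fv) (DWin-⊇ˢ S⊆S′ w)
  DWin-⊇ˢ {S} {S′} {D} {c = c} S⊆S′ (smove (w , fw) f) = smove (w , Free-⊆ˢ S⊆S′ fw) reply
    where
    reply : ∀ u → Free D S u → DWin G D (S ∪ ⁅ u ⁆) dom c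
    reply u (u∉D , _) with u ∈? S′
    ... | yes u∈S′ = DWin-⊇ˢ (λ v∈ → p⊆p∪q ⁅ w ⁆ (∪⁅⁆-⊆ S⊆S′ u∈S′ v∈)) (f w fw)
    ... | no  u∉S′ = DWin-⊇ˢ (∪⁅⁆-mono S⊆S′) (f u (u∉D , u∉S′))

  DWin-skip : S ⊆ S′ → DWin G D S′ stal c → DWin G D S dom c
  DWin-skip _     (done dom-D)       = done dom-D
  DWin-skip S⊆S′ (smove (w , fw) f) = DWin-⊇ˢ (λ v∈S → p⊆p∪q ⁅ w ⁆ (S⊆S′ v∈S)) (f w fw)

  DWin-stal⇒dom : DWin G D S stal c → DWin G D S dom c
  DWin-stal⇒dom = DWin-skip (λ v∈S → v∈S)

  mutual
    SWin-⊆ˢ : Disjoint D S′ → S ⊆ S′ → SWin G D S t → SWin G D S′ t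
    SWin-⊆ˢ _ S⊆S′ (hit hits) = hit (Hits-⊆ S⊆S′ hits)
    SWin-⊆ˢ {S′ = S′} D#S′ S⊆S′ (smove v (v∉D , _) w) with v ∈? S′
    ... | yes v∈S′ = SWin-skip D#S′ (∪⁅⁆-⊆ S⊆S′ v∈S′) w
    ... | no  v∉S′ = smove v (v∉D , v∉S′) (SWin-⊆ˢ (Disjoint-∪ˢ D#S′ v∉D) (∪⁅⁆-mono S⊆S′) w)
    SWin-⊆ˢ {D} {S′} D#S′ S⊆S′ (dmove fw g) with free? D S′
    ... | yes fu =
      dmove fu (λ v fv → SWin-⊆ˢ (Disjoint-∪ᴰ D#S′ (proj₂ fv)) S⊆S′ (g v (Free-⊆ˢ S⊆S′ fv)))
    ... | no stuck =
      hit (stuck⇒Hits stuck (SWin⇒¬Dominating (dmove fw g) (λ v∈D v∈S → D#S′ v∈D (S⊆S′ v∈S))))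

    SWin-skip : Disjoint D S′ → S ⊆ S′ → SWin G D S dom → SWin G D S′ stal
    SWin-skip {D} {S′} D#S′ S⊆S′ w with free? D S′
    ... | yes (u , u∉D , u∉S′) =
      smove u (u∉D , u∉S′) (SWin-⊆ˢ (Disjoint-∪ˢ D#S′ u∉D) (λ v∈S → p⊆p∪q ⁅ u ⁆ (S⊆S′ v∈S)) w)
    ... | no stuck = hit (stuck⇒Hits stuck (SWin⇒¬Dominating w (λ v∈D v∈S → D#S′ v∈D (S⊆S′ v∈S))))

  SWin-dom⇒stal : Disjoint D S → SWin G D S dom → SWin G D S stal
  SWin-dom⇒stal D#S = SWin-skip D#S (λ v∈S → v∈S)

module Corona (G H : Graph) where

  n m : ℕ
  n = order G
  m = order H

  C : Graph
  C = G ⊙ H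

  N : ℕ
  N = order C

  apex : Fin n → Fin N
  apex i = i ↑ˡ (n * m)

  leaf : Fin n → Fin m → Fin N
  leaf i a = n ↑ʳ combine i a

  private
    block-combine : ∀ i a → proj₁ (remQuot {n} m (combine i a)) ≡ i
    block-combine i a = cong proj₁ (remQuot-combine i a)

    vertex-combine : ∀ i a → proj₂ (remQuot {n} m (combine i a)) ≡ a
    vertex-combine i a = cong proj₂ (remQuot-combine {n} {m} i a)

  data Kind : Fin N → Set where
    isApex : ∀ i → Kind (apex i)
    isLeaf : ∀ i a → Kind (leaf i a)

  kind : ∀ v → Kind v
  kind v with splitAt n v in split
  ... | inj₁ i = subst Kind (splitAt⁻¹-↑ˡ split) (isApex i)
  ... | inj₂ p = subst Kind (trans (cong (n ↑ʳ_) (combine-remQuot {n} m p)) (splitAt⁻¹-↑ʳ split))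
                        (isLeaf (proj₁ (remQuot {n} m p)) (proj₂ (remQuot {n} m p)))

  blockOf : Fin N → Fin n
  blockOf v = [ id , (λ p → proj₁ (remQuot {n} m p)) ]′ (splitAt n v)

  blockOf-apex : ∀ i → blockOf (apex i) ≡ i
  blockOf-apex i rewrite splitAt-↑ˡ n i (n * m) = refl

  blockOf-leaf : ∀ i a → blockOf (leaf i a) ≡ i
  blockOf-leaf i a rewrite splitAt-↑ʳ n (n * m) (combine i a) = block-combine i a

  leaf-injectiveʳ : ∀ {i a b} → leaf i a ≡ leaf i b → a ≡ b
  leaf-injectiveʳ {i} {a} {b} eq =
    cong proj₂ (trans (sym (remQuot-combine i a))
               (trans (cong (remQuot {n} m) (↑ʳ-injective n _ _ eq)) (remQuot-combine i b)))

  apex≢leaf : ∀ {i j a} → apex i ≢ leaf j a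
  apex≢leaf {i} {j} {a} eq
    with trans (sym (splitAt-↑ˡ n i (n * m))) (trans (cong (splitAt n) eq) (splitAt-↑ʳ n (n * m) (combine j a)))
  ... | ()

  adj-apex-leaf : ∀ j i a → adj C (apex j) (leaf i a) ≡ ⌊ j ≟ i ⌋
  adj-apex-leaf j i a
    rewrite splitAt-↑ˡ n j (n * m) | splitAt-↑ʳ n (n * m) (combine i a) | block-combine i a = refl

  adj-leaf-apex : ∀ j b i → adj C (leaf j b) (apex i) ≡ ⌊ i ≟ j ⌋
  adj-leaf-apex j b i
    rewrite splitAt-↑ˡ n i (n * m) | splitAt-↑ʳ n (n * m) (combine j b) | block-combine j b = refl

  adj-leaf-leaf : ∀ j b i a → adj C (leaf j b) (leaf i a) ≡ ⌊ j ≟ i ⌋ ∧ adj H b a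
  adj-leaf-leaf j b i a
    rewrite splitAt-↑ʳ n (n * m) (combine j b) | splitAt-↑ʳ n (n * m) (combine i a)
          | block-combine j b | block-combine i a =
    cong₂ (λ b′ a′ → ⌊ j ≟ i ⌋ ∧ adj H b′ a′) (vertex-combine j b) (vertex-combine i a)

  private
    variable
      i j : Fin n
      a : Fin m
      v : Fin N
      D D′ S : Subset N

    ⌊≟⌋-true : ⌊ j ≟ i ⌋ ≡ true → j ≡ i
    ⌊≟⌋-true {j} {i} eq with j ≟ i
    ... | yes j≡i = j≡i

    ⌊i≟i⌋ : ∀ (i : Fin n) → ⌊ i ≟ i ⌋ ≡ true
    ⌊i≟i⌋ i with i ≟ i
    ... | yes _  = refl
    ... | no i≢i = ⊥-elim (i≢i refl)

    ∧-true : ∀ {x y} → x ∧ y ≡ true → x ≡ true × y ≡ true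
    ∧-true {true} {true} _ = refl , refl

  -- Opaque, so that unification can read i and D off leaves i D.
  opaque
    leaves : Fin n → Subset N → Subset m
    leaves i D = tabulate (λ a → lookup D (leaf i a))

    ∈-leaves⁺ : leaf i a ∈ D → a ∈ leaves i D
    ∈-leaves⁺ {a = a} {D} leaf∈D = lookup⇒[]= a _ (trans (lookup∘tabulate _ a) ([]=⇒lookup leaf∈D))

    ∈-leaves⁻ : a ∈ leaves i D → leaf i a ∈ D
    ∈-leaves⁻ {a = a} {D = D} a∈ = lookup⇒[]= _ D (trans (sym (lookup∘tabulate _ a)) ([]=⇒lookup a∈))

  leaves-mono : D ⊆ D′ → leaves i D ⊆ leaves i D′
  leaves-mono D⊆D′ a∈ = ∈-leaves⁺ (D⊆D′ (∈-leaves⁻ a∈))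

  leaves-∅ : leaves i ∅ ≡ ∅
  leaves-∅ = ⊆-antisym (λ a∈ → ⊥-elim (∉⊥ (∈-leaves⁻ a∈))) ⊥⊆

  leaves-∪-leaf : leaves i (D ∪ ⁅ leaf i a ⁆) ≡ leaves i D ∪ ⁅ a ⁆
  leaves-∪-leaf {i} {D} {a} = ⊆-antisym forth back
    where
    forth : leaves i (D ∪ ⁅ leaf i a ⁆) ⊆ leaves i D ∪ ⁅ a ⁆
    forth b∈ with ∈-∪⁅⁆⁻ (∈-leaves⁻ b∈)
    ... | inj₁ leaf∈D = p⊆p∪q ⁅ a ⁆ (∈-leaves⁺ leaf∈D)
    ... | inj₂ eq     = subst (_∈ _) (sym (leaf-injectiveʳ eq)) (y∈p∪⁅y⁆ _ a)
    back : leaves i D ∪ ⁅ a ⁆ ⊆ leaves i (D ∪ ⁅ leaf i a ⁆)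
    back b∈ with ∈-∪⁅⁆⁻ b∈
    ... | inj₁ b∈D  = leaves-mono (p⊆p∪q _) b∈D
    ... | inj₂ refl = ∈-leaves⁺ (y∈p∪⁅y⁆ D (leaf i a))

  leaves-∪-nonleaf : (∀ a → leaf i a ≢ v) → leaves i (D ∪ ⁅ v ⁆) ≡ leaves i D
  leaves-∪-nonleaf {i} {v} {D} ≢v = ⊆-antisym forth (leaves-mono (p⊆p∪q _))
    where
    forth : leaves i (D ∪ ⁅ v ⁆) ⊆ leaves i D
    forth {a} a∈ with ∈-∪⁅⁆⁻ (∈-leaves⁻ a∈)
    ... | inj₁ leaf∈D = ∈-leaves⁺ leaf∈D
    ... | inj₂ eq     = ⊥-elim (≢v a eq)

  leaves-∪-apex : leaves i (D ∪ ⁅ apex j ⁆) ≡ leaves i D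
  leaves-∪-apex = leaves-∪-nonleaf (λ _ eq → apex≢leaf (sym eq))

  outside-block : blockOf v ≡ j → i ≢ j → blockOf v ≢ i
  outside-block v∈j i≢j v∈i = i≢j (trans (sym v∈i) v∈j)

  leaves-∪-other : blockOf v ≢ i → leaves i (D ∪ ⁅ v ⁆) ≡ leaves i D
  leaves-∪-other {v} {i} other =
    leaves-∪-nonleaf (λ a eq → other (trans (cong blockOf (sym eq)) (blockOf-leaf i a)))

  apex-∉-∪-other : blockOf v ≢ i → apex i ∉ D → apex i ∉ D ∪ ⁅ v ⁆
  apex-∉-∪-other {v} {i} other apex∉D =
    ∉-∪⁅⁆ apex∉D (λ eq → other (trans (cong blockOf (sym eq)) (blockOf-apex i)))

  Free-leaf⁺ : Free (leaves i D) (leaves i S) a → Free D S (leaf i a)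
  Free-leaf⁺ (a∉D , a∉S) = a∉D ∘ ∈-leaves⁺ , a∉S ∘ ∈-leaves⁺

  Free-leaf⁻ : Free D S (leaf i a) → Free (leaves i D) (leaves i S) a
  Free-leaf⁻ (leaf∉D , leaf∉S) = leaf∉D ∘ ∈-leaves⁻ , leaf∉S ∘ ∈-leaves⁻

  Disjoint-leaves : Disjoint D S → Disjoint (leaves i D) (leaves i S)
  Disjoint-leaves D#S a∈D a∈S = D#S (∈-leaves⁻ a∈D) (∈-leaves⁻ a∈S)

  Dominating⇒leaves : Dominating C D → apex i ∉ D → Dominating H (leaves i D)
  Dominating⇒leaves {D} {i} dom-D apex∉D a with dom-D (leaf i a)
  ... | inj₁ leaf∈D = inj₁ (∈-leaves⁺ leaf∈D)
  ... | inj₂ (u , u∈D , adj-u) with kind u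
  ...   | isApex j with ⌊≟⌋-true (trans (sym (adj-apex-leaf j i a)) adj-u)
  ...     | refl = ⊥-elim (apex∉D u∈D)
  Dominating⇒leaves {D} {i} dom-D apex∉D a | inj₂ (u , u∈D , adj-u) | isLeaf j b
    with ∧-true (trans (sym (adj-leaf-leaf j b i a)) adj-u)
  ... | j≡i , adj-ba with ⌊≟⌋-true {j} {i} j≡i
  ...   | refl = inj₂ (b , ∈-leaves⁺ u∈D , adj-ba)

  -- The vertex of H is needed for a dominated H_i to dominate its apex.
  blockwise⇒Dominating : Fin m → (∀ i → apex i ∈ D ⊎ Dominating H (leaves i D)) → Dominating C D
  blockwise⇒Dominating {D} a₀ blocks v with kind v
  ... | isApex i with blocks i
  ...   | inj₁ apex∈D = inj₁ apex∈D
  ...   | inj₂ dom-L with dom-L a₀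
  ...     | inj₁ a₀∈L = inj₂ (leaf i a₀ , ∈-leaves⁻ a₀∈L , trans (adj-leaf-apex i a₀ i) (⌊i≟i⌋ i))
  ...     | inj₂ (b , b∈L , _) = inj₂ (leaf i b , ∈-leaves⁻ b∈L , trans (adj-leaf-apex i b i) (⌊i≟i⌋ i))
  blockwise⇒Dominating {D} a₀ blocks v | isLeaf i a with blocks i
  ... | inj₁ apex∈D = inj₂ (apex i , apex∈D , trans (adj-apex-leaf i i a) (⌊i≟i⌋ i))
  ... | inj₂ dom-L with dom-L a
  ...   | inj₁ a∈L = inj₁ (∈-leaves⁻ a∈L)
  ...   | inj₂ (b , b∈L , adj-ba) =
    inj₂ (leaf i b , ∈-leaves⁻ b∈L , trans (adj-leaf-leaf i b i a) (cong₂ _∧_ (⌊i≟i⌋ i) adj-ba))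

  blockDominated? : ∀ D i → Dec (apex i ∈ D ⊎ Dominating H (leaves i D))
  blockDominated? D i = apex i ∈? D ⊎-dec dominating? H (leaves i D)

  Untouched : Subset N → Subset N → Fin n → Set
  Untouched D S i = leaves i D ≡ ∅ × leaves i S ≡ ∅

  -- Staller plays her H-strategy inside block p; a Dominator move elsewhere
  -- counts there as a skipped move.
  SWin-block⇒¬DWin : ∀ {p t c} → apex p ∈ S → Disjoint D S →
                     SWin H (leaves p D) (leaves p S) t → ¬ DWin C D S t c
  SWin-block⇒¬DWin apex∈S D#S local (done dom-D) =
    SWin⇒¬Dominating local (Disjoint-leaves D#S) (Dominating⇒leaves dom-D (λ apex∈D → D#S apex∈D apex∈S))
  SWin-block⇒¬DWin apex∈S D#S (hit hits) (smove (w , w-free) f) =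
    SWin-block⇒¬DWin (p⊆p∪q _ apex∈S) (Disjoint-∪ˢ D#S (proj₁ w-free))
      (hit (Hits-⊆ (leaves-mono (p⊆p∪q _)) hits)) (f w w-free)
  SWin-block⇒¬DWin {p = p} apex∈S D#S (smove a a-free local) (smove _ f) =
    SWin-block⇒¬DWin (p⊆p∪q _ apex∈S) (Disjoint-∪ˢ D#S (proj₁ (Free-leaf⁺ a-free)))
      (subst (λ Y → SWin H _ Y dom) (sym leaves-∪-leaf) local) (f (leaf p a) (Free-leaf⁺ a-free))
  SWin-block⇒¬DWin {p = p} apex∈S D#S local (dmove v v-free w) with blockOf v ≟ p
  ... | no other =
    SWin-block⇒¬DWin apex∈S (Disjoint-∪ᴰ D#S (proj₂ v-free))
      (subst (λ X → SWin H X _ stal) (sym (leaves-∪-other other)) (SWin-dom⇒stal (Disjoint-leaves D#S) local)) w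
  ... | yes v∈p with kind v
  ...   | isApex j rewrite blockOf-apex j | v∈p = ⊥-elim (proj₂ v-free apex∈S)
  SWin-block⇒¬DWin apex∈S D#S (hit hits) (dmove _ v-free w) | yes v∈p | isLeaf j a
    rewrite blockOf-leaf j a | v∈p =
    SWin-block⇒¬DWin apex∈S (Disjoint-∪ᴰ D#S (proj₂ v-free)) (hit hits) w
  SWin-block⇒¬DWin apex∈S D#S (dmove _ reply) (dmove _ v-free w) | yes v∈p | isLeaf j a
    rewrite blockOf-leaf j a | v∈p =
    SWin-block⇒¬DWin apex∈S (Disjoint-∪ᴰ D#S (proj₂ v-free))
      (subst (λ X → SWin H X _ stal) (sym leaves-∪-leaf) (reply a (Free-leaf⁻ v-free))) w

module DominatorStrategy (G H : Graph) {k : ℕ} (1≤k : 1 ≤ k) (a₀ : Fin (order H))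
                         (strategyH : DWin H ∅ ∅ dom k) where

  open Corona G H

  private
    variable
      i j : Fin n
      a : Fin m
      v : Fin N
      D S : Subset N
      t : Turn
      c x : ℕ

  -- The state of block i for Dominator: c bounds the moves he may still
  -- spend there and t is the player due to move there.  In a contested block
  -- Staller owns the apex and Dominator follows a strategy for the game on H_i.
  data Block (D S : Subset N) (i : Fin n) : Turn → ℕ → Set where
    claimed   : apex i ∈ D → Block D S i t c
    untouched : Free D S (apex i) → Untouched D S i → k ≤ c → Block D S i stal c
    attacked  : Free D S (apex i) → 1 ≤ c → Block D S i dom c
    contested : apex i ∈ S → x ≤ c → DWin H (leaves i D) (leaves i S) t x → Block D S i t c

  Block-∪ᴰ-other : blockOf v ≢ i → Block D S i t c → Block (D ∪ ⁅ v ⁆) S i t c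
  Block-∪ᴰ-other other (claimed apex∈D) = claimed (p⊆p∪q _ apex∈D)
  Block-∪ᴰ-other other (untouched (apex∉D , apex∉S) (LD≡∅ , LS≡∅) k≤c) =
    untouched (apex-∉-∪-other other apex∉D , apex∉S) (trans (leaves-∪-other other) LD≡∅ , LS≡∅) k≤c
  Block-∪ᴰ-other other (attacked (apex∉D , apex∉S) 1≤c) = attacked (apex-∉-∪-other other apex∉D , apex∉S) 1≤c
  Block-∪ᴰ-other other (contested apex∈S x≤c w) =
    contested apex∈S x≤c (subst (λ X → DWin H X _ _ _) (sym (leaves-∪-other other)) w)

  Block-∪ˢ-other : blockOf v ≢ i → Block D S i t c → Block D (S ∪ ⁅ v ⁆) i t c
  Block-∪ˢ-other other (claimed apex∈D) = claimed apex∈D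
  Block-∪ˢ-other other (untouched (apex∉D , apex∉S) (LD≡∅ , LS≡∅) k≤c) =
    untouched (apex∉D , apex-∉-∪-other other apex∉S) (LD≡∅ , trans (leaves-∪-other other) LS≡∅) k≤c
  Block-∪ˢ-other other (attacked (apex∉D , apex∉S) 1≤c) = attacked (apex∉D , apex-∉-∪-other other apex∉S) 1≤c
  Block-∪ˢ-other other (contested apex∈S x≤c w) =
    contested (p⊆p∪q _ apex∈S) x≤c (subst (λ Y → DWin H _ Y _ _) (sym (leaves-∪-other other)) w)

  Block-∪ˢ-apex : Free D S (apex j) → Block D S j stal c → Block D (S ∪ ⁅ apex j ⁆) j dom c
  Block-∪ˢ-apex (apex∉D , _) (claimed apex∈D) = ⊥-elim (apex∉D apex∈D)
  Block-∪ˢ-apex {S = S} _ (untouched _ (LD≡∅ , LS≡∅) k≤c) =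
    contested (y∈p∪⁅y⁆ S _) k≤c
      (subst₂ (λ X Y → DWin H X Y dom k) (sym LD≡∅) (sym (trans leaves-∪-apex LS≡∅)) strategyH)
  Block-∪ˢ-apex (_ , apex∉S) (contested apex∈S _ _) = ⊥-elim (apex∉S apex∈S)

  Block-∪ˢ-leaf : Free D S (leaf j a) → Block D S j stal c → Block D (S ∪ ⁅ leaf j a ⁆) j dom c
  Block-∪ˢ-leaf _ (claimed apex∈D) = claimed apex∈D
  Block-∪ˢ-leaf _ (untouched (apex∉D , apex∉S) _ k≤c) =
    attacked (apex∉D , ∉-∪⁅⁆ apex∉S apex≢leaf) (≤-trans 1≤k k≤c)
  Block-∪ˢ-leaf _ (contested apex∈S x≤c (done dom-L)) = contested (p⊆p∪q _ apex∈S) x≤c (done dom-L)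
  Block-∪ˢ-leaf {a = a} leaf-free (contested apex∈S x≤c (smove _ reply)) =
    contested (p⊆p∪q _ apex∈S) x≤c
      (subst (λ Y → DWin H _ Y dom _) (sym leaves-∪-leaf) (reply a (Free-leaf⁻ leaf-free)))

  Free-in-open-block : apex i ∉ D → ¬ Dominating H (leaves i D) → Block D S i stal c → ∃ (Free D S)
  Free-in-open-block apex∉D _ (claimed apex∈D) = ⊥-elim (apex∉D apex∈D)
  Free-in-open-block {i} _ _ (untouched apex-free _ _) = apex i , apex-free
  Free-in-open-block _ ¬dom-L (contested _ _ (done dom-L)) = ⊥-elim (¬dom-L dom-L)
  Free-in-open-block {i} _ _ (contested _ _ (smove (a , a-free) _)) = leaf i a , Free-leaf⁺ a-free

  Blocks : Subset N → Subset N → Vector ℕ n → Set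
  Blocks D S c = ∀ i → Block D S i stal (c i)

  Blocks-insert : ∀ {c} → Block D S j stal (c j) → (∀ i → i ≢ j → Block D S i stal (c i)) → Blocks D S c
  Blocks-insert {j = j} block-j others i with i ≟ j
  ... | yes refl = block-j
  ... | no  i≢j  = others i i≢j

  Blocks-∪ᴰ : ∀ {c y} → blockOf v ≡ j → Block (D ∪ ⁅ v ⁆) S j stal y → (∀ i → i ≢ j → Block D S i stal (c i)) →
              Blocks (D ∪ ⁅ v ⁆) S (updateAt c j (λ _ → y))
  Blocks-∪ᴰ {j = j} {c = c} v∈j block-j others =
    Blocks-insert (subst (Block _ _ j stal) (sym (updateAt-updates j c)) block-j)
      (λ i i≢j → subst (Block _ _ i stal) (sym (updateAt-minimal i j c i≢j))
                   (Block-∪ᴰ-other (outside-block v∈j i≢j) (others i i≢j)))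

  mutual
    stallerToMove : Acc _<_ (free-count D S) → (c : Vector ℕ n) → Blocks D S c → DWin C D S stal (sum c)
    stallerToMove {D} rec c blocks with all? (blockDominated? D)
    ... | yes dominated = done (blockwise⇒Dominating a₀ dominated)
    ... | no ¬dominated with ¬∀⟶∃¬ n _ (blockDominated? D) ¬dominated
    ...   | i , open-i =
      smove (Free-in-open-block (open-i ∘ inj₁) (open-i ∘ inj₂) (blocks i))
            (λ v v-free → afterStaller rec c blocks v-free (kind v))

    afterStaller : Acc _<_ (free-count D S) → (c : Vector ℕ n) → Blocks D S c →
                   Free D S v → Kind v → DWin C D (S ∪ ⁅ v ⁆) dom (sum c)
    afterStaller (acc rec) c blocks v-free (isApex j) =
      dominatorToMove (rec (free-count-∪ˢ v-free)) j c (Block-∪ˢ-apex v-free (blocks j))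
        (λ i i≢j → Block-∪ˢ-other (outside-block (blockOf-apex j) i≢j) (blocks i))
    afterStaller (acc rec) c blocks v-free (isLeaf j a) =
      dominatorToMove (rec (free-count-∪ˢ v-free)) j c (Block-∪ˢ-leaf v-free (blocks j))
        (λ i i≢j → Block-∪ˢ-other (outside-block (blockOf-leaf j a) i≢j) (blocks i))

    dominatorToMove : Acc _<_ (free-count D S) → ∀ j (c : Vector ℕ n) → Block D S j dom (c j) →
                      (∀ i → i ≢ j → Block D S i stal (c i)) → DWin C D S dom (sum c)
    dominatorToMove rec j c (claimed apex∈D) others =
      DWin-stal⇒dom (stallerToMove rec c (Blocks-insert (claimed apex∈D) others))
    dominatorToMove rec j c (contested apex∈S x≤c (done dom-L)) others =
      DWin-stal⇒dom (stallerToMove rec c (Blocks-insert (contested apex∈S x≤c (done dom-L)) others))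
    dominatorToMove {D} (acc rec) j c (attacked apex-free 1≤c) others =
      DWin-≤ (sum-updateAt-< c j 1≤c)
        (dmove (apex j) apex-free
          (stallerToMove (rec (free-count-∪ᴰ apex-free)) _
            (Blocks-∪ᴰ (blockOf-apex j) (claimed (y∈p∪⁅y⁆ D (apex j))) others)))
    dominatorToMove (acc rec) j c (contested apex∈S x≤c (dmove a a-free w)) others =
      DWin-≤ (sum-updateAt-< c j x≤c)
        (dmove (leaf j a) (Free-leaf⁺ a-free)
          (stallerToMove (rec (free-count-∪ᴰ (Free-leaf⁺ a-free))) _
            (Blocks-∪ᴰ (blockOf-leaf j a)
              (contested apex∈S ≤-refl (subst (λ X → DWin H X _ stal _) (sym leaves-∪-leaf) w)) others)))

  untouched-∅ : k ≤ c → Block ∅ ∅ i stal c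
  untouched-∅ = untouched (∉⊥ , ∉⊥) (leaves-∅ , leaves-∅)

  DWin-S-corona : DWin C ∅ ∅ stal (n * k)
  DWin-S-corona =
    subst (DWin C ∅ ∅ stal) (sum-const n k)
      (stallerToMove (<-wellFounded _) (λ _ → k) (λ _ → untouched-∅ ≤-refl))

  -- Dominator opens on the apex of block i₀, exactly as if Staller had just
  -- attacked that block.
  DWin-D-corona : Fin n → DWin C ∅ ∅ dom (1 + (n ∸ 1) * k)
  DWin-D-corona i₀ =
    subst (DWin C ∅ ∅ dom) (sum-updateAt-const i₀ k 1)
      (dominatorToMove (<-wellFounded _) i₀ budget
        (attacked (∉⊥ , ∉⊥) (≤-reflexive (sym (updateAt-updates i₀ _))))
        (λ i i≢i₀ → untouched-∅ (≤-reflexive (sym (updateAt-minimal i i₀ _ i≢i₀)))))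
    where
    budget : Vector ℕ n
    budget = updateAt (λ _ → k) i₀ (λ _ → 1)

m∸n≤1+m∸o : ∀ m {n o} → o ≤ suc n → m ∸ n ≤ suc (m ∸ o)
m∸n≤1+m∸o m {n} {o} o≤1+n = m≤n+o⇒m∸n≤o m n (begin
  m               ≤⟨ m≤n+m∸n m o ⟩
  o + (m ∸ o)     ≤⟨ +-monoˡ-≤ (m ∸ o) o≤1+n ⟩
  suc n + (m ∸ o) ≡⟨ +-suc n (m ∸ o) ⟨
  n + suc (m ∸ o) ∎)
  where open ≤-Reasoning

n*k≤K+[k∸1]⇒1+[n∸1]*k≤K : ∀ {n k K} → 1 ≤ n → 1 ≤ k → n * k ≤ K + (k ∸ 1) → 1 + (n ∸ 1) * k ≤ K
n*k≤K+[k∸1]⇒1+[n∸1]*k≤K {suc n} {suc k} {K} _ _ nk≤ =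
  +-cancelʳ-≤ k _ _ (subst (_≤ K + k) (cong suc (+-comm k (n * suc k))) nk≤)

module StallerStrategy (G H : Graph) {k : ℕ} (1≤k : 1 ≤ k) (strategyH : SWin H ∅ ∅ stal)
                       (γ≥k : ∀ X → Dominating H X → k ≤ ∣ X ∣) where

  open Corona G H

  private
    variable
      i j : Fin n
      a : Fin m
      v : Fin N
      D S : Subset N
      K : ℕ

  -- A lower bound on the moves Dominator still has to spend in block i: if he
  -- does not own the apex, his leaves there must dominate H_i, so they are at
  -- least γ(H) ≥ k many.
  deficit : Subset N → Fin n → ℕ
  deficit D i with apex i ∈? D
  ... | yes _ = 0
  ... | no  _ = k ∸ ∣ leaves i D ∣

  potential : Subset N → ℕ
  potential D = sum (deficit D)

  deficit-≤ : deficit D i ≤ k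
  deficit-≤ {D} {i} with apex i ∈? D
  ... | yes _ = z≤n
  ... | no  _ = m∸n≤m k ∣ leaves i D ∣

  deficit-∪-other : blockOf v ≢ i → deficit (D ∪ ⁅ v ⁆) i ≡ deficit D i
  deficit-∪-other {v} {i} {D} other with apex i ∈? D ∪ ⁅ v ⁆ | apex i ∈? D
  ... | yes _     | yes _       = refl
  ... | yes apex∈ | no  apex∉D  = ⊥-elim (apex-∉-∪-other other apex∉D apex∈)
  ... | no  apex∉ | yes apex∈D  = ⊥-elim (apex∉ (p⊆p∪q _ apex∈D))
  ... | no  _     | no  _       = cong (λ L → k ∸ ∣ L ∣) (leaves-∪-other other)

  deficit-∪-apex : deficit D j ≤ k + deficit (D ∪ ⁅ apex j ⁆) j
  deficit-∪-apex {D} {j} = ≤-trans (deficit-≤ {D} {j}) (m≤m+n k _)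

  deficit-∪-leaf : deficit D j ≤ 1 + deficit (D ∪ ⁅ leaf j a ⁆) j
  deficit-∪-leaf {D} {j} {a} with apex j ∈? D | apex j ∈? D ∪ ⁅ leaf j a ⁆
  ... | yes _      | _          = z≤n
  ... | no  apex∉D | yes apex∈  = ⊥-elim (∉-∪⁅⁆ apex∉D apex≢leaf apex∈)
  ... | no  _      | no  _      rewrite leaves-∪-leaf {j} {D} {a} =
    m∸n≤1+m∸o k (∣p∪⁅x⁆∣≤1+∣p∣ (leaves j D) a)

  potential-∪-apex : potential D ≤ k + potential (D ∪ ⁅ apex j ⁆)
  potential-∪-apex {D} {j} =
    sum-≤-at j (λ i i≢j → sym (deficit-∪-other {D = D} (outside-block (blockOf-apex j) i≢j))) 0 k
      (deficit-∪-apex {D} {j})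

  potential-∪-leaf : potential D ≤ 1 + potential (D ∪ ⁅ leaf j a ⁆)
  potential-∪-leaf {D} {j} {a} =
    sum-≤-at j (λ i i≢j → sym (deficit-∪-other {D = D} (outside-block (blockOf-leaf j a) i≢j))) 0 1
      (deficit-∪-leaf {D} {j} {a})

  potential-∅ : potential ∅ ≡ n * k
  potential-∅ = trans (sum-cong-≗ deficit-∅) (sum-const n k)
    where
    deficit-∅ : ∀ i → deficit ∅ i ≡ k
    deficit-∅ i with apex i ∈? ∅
    ... | yes apex∈∅ = ⊥-elim (∉⊥ apex∈∅)
    ... | no  _      rewrite leaves-∅ {i} | ∣⊥∣≡0 m = refl

  potential-dominating : Dominating C D → potential D ≡ 0
  potential-dominating {D} dom-D = trans (sum-cong-≗ deficit-0) (trans (sum-const n 0) (*-zeroʳ n))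
    where
    deficit-0 : ∀ i → deficit D i ≡ 0
    deficit-0 i with apex i ∈? D
    ... | yes _      = refl
    ... | no  apex∉D = m≤n⇒m∸n≡0 (γ≥k _ (Dominating⇒leaves dom-D apex∉D))

  OpenUntouchedOff : Fin n → Subset N → Subset N → Set
  OpenUntouchedOff j D S = ∀ i → i ≢ j → Free D S (apex i) → Untouched D S i

  OpenUntouched : Subset N → Subset N → Set
  OpenUntouched D S = ∀ i → Free D S (apex i) → Untouched D S i

  OpenUntouched⇒Off : OpenUntouched D S → OpenUntouchedOff j D S
  OpenUntouched⇒Off untouched i _ = untouched i

  OpenUntouchedOff⇒ : OpenUntouchedOff j D S → ¬ Free D S (apex j) → OpenUntouched D S
  OpenUntouchedOff⇒ {j} untouched taken i with i ≟ j
  ... | yes refl = ⊥-elim ∘ taken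
  ... | no  i≢j  = untouched i i≢j

  OpenUntouchedOff-∪ᴰ : blockOf v ≡ j → OpenUntouchedOff j D S → OpenUntouchedOff j (D ∪ ⁅ v ⁆) S
  OpenUntouchedOff-∪ᴰ v∈j untouched i i≢j apex-free with untouched i i≢j (Free-∪ᴰ⁻ apex-free)
  ... | LD≡∅ , LS≡∅ = trans (leaves-∪-other (outside-block v∈j i≢j)) LD≡∅ , LS≡∅

  OpenUntouchedOff-∪ˢ : blockOf v ≡ j → OpenUntouchedOff j D S → OpenUntouchedOff j D (S ∪ ⁅ v ⁆)
  OpenUntouchedOff-∪ˢ v∈j untouched i i≢j apex-free with untouched i i≢j (Free-∪ˢ⁻ apex-free)
  ... | LD≡∅ , LS≡∅ = LD≡∅ , trans (leaves-∪-other (outside-block v∈j i≢j)) LS≡∅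

  NoApex : Subset N → Set
  NoApex D = ∀ i → apex i ∉ D

  Captured : Subset N → Subset N → Set
  Captured D S = ∃ λ p → apex p ∈ S × Untouched D S p

  ApexesTaken : Subset N → Subset N → Set
  ApexesTaken D S = ∀ i → ¬ Free D S (apex i)

  data LeafOfTakenBlock (D S : Subset N) : Fin N → Set where
    leafOf : ∀ {j} a → ¬ Free D S (apex j) → LeafOfTakenBlock D S (leaf j a)

  -- Outside a captured block Dominator loses at once: Staller, owning its
  -- apex, wins the S-game on its copy of H.
  confined-move : ∀ {c} → Captured D S ⊎ ApexesTaken D S → Disjoint D S → Free D S v →
                  DWin C (D ∪ ⁅ v ⁆) S stal c → LeafOfTakenBlock D S v
  confined-move {v = v} (inj₁ (p , apex∈S , LD≡∅ , LS≡∅)) D#S v-free w with blockOf v ≟ p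
  ... | no other = ⊥-elim (SWin-block⇒¬DWin apex∈S (Disjoint-∪ᴰ D#S (proj₂ v-free))
                     (subst₂ (λ X Y → SWin H X Y stal) (sym (trans (leaves-∪-other other) LD≡∅)) (sym LS≡∅)
                             strategyH) w)
  ... | yes v∈p with kind v
  ...   | isApex j rewrite blockOf-apex j | v∈p = ⊥-elim (proj₂ v-free apex∈S)
  ...   | isLeaf j a rewrite blockOf-leaf j a | v∈p = leafOf a (λ apex-free → proj₂ apex-free apex∈S)
  confined-move {v = v} (inj₂ taken) _ v-free _ with kind v
  ... | isApex j   = ⊥-elim (taken j v-free)
  ... | isLeaf j a = leafOf a (taken j)

  k+K≡1+K+[k∸1] : ∀ K → k + K ≡ suc K + (k ∸ 1)
  k+K≡1+K+[k∸1] K = trans (cong (_+ K) (sym (m+[n∸m]≡n 1≤k))) (cong suc (+-comm (k ∸ 1) K))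

  potential-dominating≤ : Dominating C D → potential D ≤ K
  potential-dominating≤ dom-D = ≤-trans (≤-reflexive (potential-dominating dom-D)) z≤n

  mutual
    bound-noApex : DWin C D S dom K → Disjoint D S → OpenUntouched D S → NoApex D → potential D ≤ K + (k ∸ 1)
    bound-noApex (done dom-D) _ _ _ = potential-dominating≤ dom-D
    bound-noApex {D} {S} (dmove v v-free w) D#S untouched noApex with kind v
    ... | isApex j = begin
      potential D                        ≤⟨ potential-∪-apex ⟩
      k + potential (D ∪ ⁅ apex j ⁆)     ≤⟨ +-monoʳ-≤ k (reply w (Disjoint-∪ᴰ D#S (proj₂ v-free)) untouched′) ⟩
      k + _                              ≡⟨ k+K≡1+K+[k∸1] _ ⟩
      _                                  ∎
      where
      open ≤-Reasoning
      untouched′ : OpenUntouched (D ∪ ⁅ apex j ⁆) S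
      untouched′ = OpenUntouchedOff⇒ (OpenUntouchedOff-∪ᴰ (blockOf-apex j) (OpenUntouched⇒Off untouched))
                                     ¬Free-∪ᴰ
    ... | isLeaf j a = ≤-trans potential-∪-leaf
      (s≤s (reply-noApex w (Disjoint-∪ᴰ D#S (proj₂ v-free))
              (OpenUntouchedOff-∪ᴰ (blockOf-leaf j a) (OpenUntouched⇒Off untouched))
              (λ i apex∈ → ∉-∪⁅⁆ (noApex i) apex≢leaf apex∈)))

    bound-confined : DWin C D S dom K → Disjoint D S → OpenUntouched D S → Captured D S ⊎ ApexesTaken D S →
                     potential D ≤ K
    bound-confined (done dom-D) _ _ _ = potential-dominating≤ dom-D
    bound-confined (dmove v v-free w) D#S untouched confined with confined-move confined D#S v-free w
    ... | leafOf {j} a taken = ≤-trans potential-∪-leaf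
      (s≤s (reply w (Disjoint-∪ᴰ D#S (proj₂ v-free))
              (OpenUntouchedOff⇒ (OpenUntouchedOff-∪ᴰ (blockOf-leaf j a) (OpenUntouched⇒Off untouched))
                                 (taken ∘ Free-∪ᴰ⁻))))

    reply-noApex : DWin C D S stal K → Disjoint D S → OpenUntouchedOff j D S → NoApex D → potential D ≤ K + (k ∸ 1)
    reply-noApex (done dom-D) _ _ _ = potential-dominating≤ dom-D
    reply-noApex {D} {S} {j = j} (smove fw f) D#S untouched noApex with apex j ∈? S
    ... | yes apex∈S =
      ≤-trans (reply (smove fw f) D#S (OpenUntouchedOff⇒ untouched (λ apex-free → proj₂ apex-free apex∈S)))
              (m≤m+n _ _)
    ... | no apex∉S =
      bound-noApex (f (apex j) (noApex j , apex∉S)) (Disjoint-∪ˢ D#S (noApex j))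
        (OpenUntouchedOff⇒ (OpenUntouchedOff-∪ˢ (blockOf-apex j) untouched) ¬Free-∪ˢ)
        noApex

    reply : DWin C D S stal K → Disjoint D S → OpenUntouched D S → potential D ≤ K
    reply (done dom-D) _ _ = potential-dominating≤ dom-D
    reply {D} {S} (smove (w , w-free) f) D#S untouched with any? (λ i → ¬? (apex i ∈? D) ×-dec ¬? (apex i ∈? S))
    ... | yes (i , apex-free) =
      bound-confined (f (apex i) apex-free) (Disjoint-∪ˢ D#S (proj₁ apex-free))
        (OpenUntouchedOff⇒ (OpenUntouchedOff-∪ˢ (blockOf-apex i) (OpenUntouched⇒Off untouched)) ¬Free-∪ˢ)
        (inj₁ (i , y∈p∪⁅y⁆ S (apex i) ,
               proj₁ (untouched i apex-free) , trans leaves-∪-apex (proj₂ (untouched i apex-free))))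
    ... | no none =
      bound-confined (f w w-free) (Disjoint-∪ˢ D#S (proj₁ w-free))
        (λ i apex-free → ⊥-elim (none (i , Free-∪ˢ⁻ apex-free)))
        (inj₂ (λ i apex-free → none (i , Free-∪ˢ⁻ apex-free)))

  OpenUntouched-∅ : OpenUntouched ∅ ∅
  OpenUntouched-∅ _ _ = leaves-∅ , leaves-∅

  DWin-S-corona-≥ : DWin C ∅ ∅ stal K → n * k ≤ K
  DWin-S-corona-≥ w = subst (_≤ _) potential-∅ (reply w Disjoint-∅ OpenUntouched-∅)

  DWin-D-corona-≥ : 1 ≤ n → DWin C ∅ ∅ dom K → 1 + (n ∸ 1) * k ≤ K
  DWin-D-corona-≥ 1≤n w =
    n*k≤K+[k∸1]⇒1+[n∸1]*k≤K 1≤n 1≤k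
      (subst (_≤ _) potential-∅ (bound-noApex w Disjoint-∅ OpenUntouched-∅ (λ _ → ∉⊥)))

vertex-of-SWin : ∀ {G D S t} → SWin G D S t → Fin (order G)
vertex-of-SWin (hit hits)         = proj₁ (hits ⊤ (λ _ → inj₁ ∈⊤))
vertex-of-SWin (smove v _ _)      = v
vertex-of-SWin (dmove (w , _) _) = w

Dominating⇒nonempty : ∀ {G X} → Fin (order G) → Dominating G X → ∃ (_∈ X)
Dominating⇒nonempty a dom-X with dom-X a
... | inj₁ a∈X            = a , a∈X
... | inj₂ (u , u∈X , _) = u , u∈X

DWin-∅⇒1≤ : ∀ {G k} → Fin (order G) → DWin G ∅ ∅ dom k → 1 ≤ k
DWin-∅⇒1≤ {k = zero}  a (done dom-∅) = ⊥-elim (∉⊥ (proj₂ (Dominating⇒nonempty a dom-∅)))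
DWin-∅⇒1≤ {k = suc _} _ _            = s≤s z≤n

-- A dominating set X with a single element u would let Dominator win the
-- D-game at once by claiming u.
γMB≥2⇒γ≥2 : ∀ {G} → Fin (order G) → (∀ j → DWin G ∅ ∅ dom j → 2 ≤ j) → ∀ X → Dominating G X → 2 ≤ ∣ X ∣
γMB≥2⇒γ≥2 a γMB≥2 X dom-X with Dominating⇒nonempty a dom-X
... | u , u∈X with any? (λ w → w ∈? X ×-dec ¬? (w ≟ u))
...   | yes (w , w∈X , w≢u) = x,y∈p⇒2≤∣p∣ w∈X u∈X w≢u
...   | no  ¬other = ⊥-elim (n≮n 1 (γMB≥2 1 (dmove u (∉⊥ , ∉⊥) (done (Dominating-⊆ X⊆∅∪u dom-X)))))
  where
  X⊆∅∪u : X ⊆ ∅ ∪ ⁅ u ⁆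
  X⊆∅∪u {w} w∈X with w ≟ u
  ... | yes refl = y∈p∪⁅y⁆ ∅ u
  ... | no  w≢u  = ⊥-elim (¬other (w , w∈X , w≢u))

corona-γMB : (G H : Graph) → OutcomeN H → ∀ k → IsγMB H k → (∀ X → Dominating H X → k ≤ ∣ X ∣) →
             1 ≤ order G → IsγMB (G ⊙ H) (1 + (order G ∸ 1) * k) × IsγMB' (G ⊙ H) (order G * k)
corona-γMB G H (_ , SWin-H) k (DWin-H , _) γ≥k 1≤n =
  (Upper.DWin-D-corona (fromℕ< 1≤n) , λ _ → Lower.DWin-D-corona-≥ 1≤n) ,
  (Upper.DWin-S-corona , λ _ → Lower.DWin-S-corona-≥)
  where
  a₀ : Fin (order H)
  a₀ = vertex-of-SWin SWin-H
  1≤k : 1 ≤ k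
  1≤k = DWin-∅⇒1≤ a₀ DWin-H
  module Upper = DominatorStrategy G H 1≤k a₀ DWin-H
  module Lower = StallerStrategy G H 1≤k SWin-H γ≥k

1+[n∸1]*2≡2*n∸1 : ∀ {n} → 1 ≤ n → 1 + (n ∸ 1) * 2 ≡ 2 * n ∸ 1
1+[n∸1]*2≡2*n∸1 {suc n} _ = trans (cong suc (*-comm n 2)) (sym (+-suc n (n + 0)))

corona-γMB≡2 : (G H : Graph) → OutcomeN H → IsγMB H 2 → 1 ≤ order G →
               IsγMB (G ⊙ H) (2 * order G ∸ 1) × IsγMB' (G ⊙ H) (2 * order G)
corona-γMB≡2 G H outcome γMB 1≤n =
  map (subst (IsγMB (G ⊙ H)) (1+[n∸1]*2≡2*n∸1 1≤n)) (subst (IsγMB' (G ⊙ H)) (*-comm (order G) 2))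
      (corona-γMB G H outcome 2 γMB (γMB≥2⇒γ≥2 (vertex-of-SWin (proj₂ outcome)) (proj₂ γMB)) 1≤n)

corollary3p6 :
    ((G H : Graph) → IsSimple G → IsSimple H → OutcomeN H →
      (k : ℕ) → IsγMB H k → IsDominationNumber H k → 2 ≤ order G →
      IsγMB (G ⊙ H) (1 + (order G ∸ 1) * k) × IsγMB' (G ⊙ H) (order G * k))
    ×
    ((G H : Graph) → IsSimple G → IsSimple H → OutcomeN H → IsγMB H 2 →
      2 ≤ order G →
      IsγMB (G ⊙ H) (2 * order G ∸ 1) × IsγMB' (G ⊙ H) (2 * order G))
corollary3p6 =
  (λ G H _ _ outcome k γMB γ 2≤n → corona-γMB G H outcome k γMB (proj₂ γ) (<⇒≤ 2≤n)) ,
  (λ G H _ _ outcome γMB 2≤n → corona-γMB≡2 G H outcome γMB (<⇒≤ 2≤n))
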